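{- Let $H_i$ be a set of hypotheses all of whose right-hand sides are words, let $H_j$ be a set of hypotheses all of whose left-hand sides are words, and let $g$ be a contextual function on languages. If for every hypothesis $e\le u$ of $H_i$, every hypothesis $v\le f$ of $H_j$, and every overlap $\langle x,y,s,t\rangle$ of $u,v$, we have $x\llbracket e\rrbracket y\subseteq g(s\llbracket f\rrbracket t)$, then $H_i\circ H_j\subseteq (H_j\circ H_i)\cup g$.
   Context: Regular expressions over an alphabet $\Sigma$ with usual language $\llbracket e\rrbracket$; for words $x,y$ and a language $K$, $xKy=\{xwy\mid w\in K\}$. A hypothesis is a pair $e\le f$ of regular expressions. For a set $G$ of hypotheses, the one-step function on languages (also denoted $G$) is $G(L)=\bigcup\{u\llbracket e\rrbracket v\mid e\le f\in G,\ u,v\in\Sigma^*,\ u\llbracket f\rrbracket v\subseteq L\}$. Functions on languages are composed with $\circ$, and $\subseteq$, $\cup$ are pointwise. A monotone function $g$ on languages is contextual if $u\cdot g(K)\cdot v\subseteq g(u\cdot K\cdot v)$ for all words $u,v$ and languages $K$. An overlap of words $u,v$ is a tuple $\langle x,y,s,t\rangle$ of words with $xuy=svt$ and either: $x,t$ empty and $|y|<|v|$; or $y,s$ empty and $|x|<|v|$; or $x,y$ empty and $s,t$ non-empty; or $s,t$ empty and $x,y$ non-empty. -}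

module Defs where

open import Data.List using (List; []; _∷_; _++_; length)
open import Data.Nat using (_<_)
open import Data.Product using (Σ; ∃; _×_; _,_)
open import Data.Sum using (_⊎_)
open import Data.Empty using (⊥)
open import Relation.Nullary using (¬_)
open import Relation.Binary.PropositionalEquality using (_≡_)

module _ (A : Set) where

  Word : Set
  Word = List A

  Language : Set₁
  Language = Word → Set

  data RegExp : Set where
    𝟘    : RegExp
    𝟙    : RegExp
    lit  : A → RegExp
    _⊕_  : RegExp → RegExp → RegExp
    _⊙_  : RegExp → RegExp → RegExp
    _⋆   : RegExp → RegExp

  data ⟦_⟧ : RegExp → Language where
    one  : ⟦ 𝟙 ⟧ []
    lit  : (a : A) → ⟦ lit a ⟧ (a ∷ [])
    inl  : ∀ {e f w} → ⟦ e ⟧ w → ⟦ e ⊕ f ⟧ w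
    inr  : ∀ {e f w} → ⟦ f ⟧ w → ⟦ e ⊕ f ⟧ w
    cat  : ∀ {e f w₁ w₂} → ⟦ e ⟧ w₁ → ⟦ f ⟧ w₂ → ⟦ e ⊙ f ⟧ (w₁ ++ w₂)
    nil  : ∀ {e} → ⟦ e ⋆ ⟧ []
    cons : ∀ {e w₁ w₂} → ⟦ e ⟧ w₁ → ⟦ e ⋆ ⟧ w₂ → ⟦ e ⋆ ⟧ (w₁ ++ w₂)

  word : Word → RegExp
  word []       = 𝟙
  word (a ∷ w)  = lit a ⊙ word w

  _⊆_ : Language → Language → Set
  K ⊆ L = ∀ w → K w → L w

  _∪_ : Language → Language → Language
  (K ∪ L) w = K w ⊎ L w

  -- x K y = { x w y | w ∈ K }
  ctx : Word → Language → Word → Language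
  ctx x K y w = Σ Word λ w' → K w' × (w ≡ x ++ w' ++ y)

  -- hypotheses e ≤ f, and sets of hypotheses as predicates
  Hyp : Set
  Hyp = RegExp × RegExp

  HypSet : Set₁
  HypSet = Hyp → Set

  step : HypSet → Language → Language
  step G L w =
    Σ RegExp λ e → Σ RegExp λ f → Σ Word λ u → Σ Word λ v →
      G (e , f) × (ctx u ⟦ f ⟧ v ⊆ L) × ctx u ⟦ e ⟧ v w

  _∘ₗ_ : (Language → Language) → (Language → Language) → (Language → Language)
  (g ∘ₗ h) L = g (h L)

  _⊑_ : (Language → Language) → (Language → Language) → Set₁
  g ⊑ h = ∀ L → g L ⊆ h L

  _∪ₗ_ : (Language → Language) → (Language → Language) → (Language → Language)
  (g ∪ₗ h) L = g L ∪ h L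

  Monotone : (Language → Language) → Set₁
  Monotone g = ∀ K L → K ⊆ L → g K ⊆ g L

  Contextual : (Language → Language) → Set₁
  Contextual g = Monotone g × (∀ u v K → ctx u (g K) v ⊆ g (ctx u K v))

  RhsWords : HypSet → Set
  RhsWords H = ∀ e f → H (e , f) → Σ Word λ u → f ≡ word u

  LhsWords : HypSet → Set
  LhsWords H = ∀ e f → H (e , f) → Σ Word λ v → e ≡ word v

  Empty : Word → Set
  Empty w = w ≡ []

  Overlap : Word → Word → Word → Word → Word → Word → Set
  Overlap u v x y s t =
    (x ++ u ++ y ≡ s ++ v ++ t) ×
    ( (Empty x × Empty t × length y < length v)
    ⊎ (Empty y × Empty s × length x < length v)
    ⊎ (Empty x × Empty y × ¬ Empty s × ¬ Empty t)
    ⊎ (Empty s × Empty t × ¬ Empty x × ¬ Empty y))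

{-# OPTIONS --safe #-}
-- A word of Hi (Hj L) is p e q with p u q ∈ Hj L, i.e. p u q = p′ v q′ with p′ f q′ ⊆ L.
-- The two occurrences of u and v in this word are either disjoint, and then the two
-- rewriting steps can be performed in the other order, or they form an overlap
-- ⟨x,y,s,t⟩ inside a common context c _ d; then the hypothesis on overlaps, carried
-- into the context c _ d by contextuality of g, puts the word in g L.
module Submission where

open import Defs
open import Data.Product using (_,_; _×_; ∃)
open import Data.Sum using (_⊎_; inj₁; inj₂)
open import Data.List using ([]; _∷_; _++_; length)
open import Data.List.Properties using (++-monoid; ++-assoc; ∷-injective; ++-identityʳ; length-++)
open import Data.Nat using (_+_; _<_; s≤s; z≤n)
open import Data.Nat.Properties
  using (+-comm; _≤?_; +-mono-<-≤; <⇒≢; ≰⇒>; m≤n+m; ≤-trans; ≤-reflexive)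
open import Function using (_∘_)
open import Relation.Nullary using (yes; no; contradiction)
open import Relation.Binary.PropositionalEquality using (_≡_; refl; sym; trans; cong; subst)
open import Tactic.MonoidSolver using (solve)

+-<-transfer : ∀ {a b c d} → a + b ≡ c + d → a < c → d < b
+-<-transfer {b = b} {d = d} eq a<c with b ≤? d
... | yes b≤d = contradiction eq (<⇒≢ (+-mono-<-≤ a<c b≤d))
... | no b≰d  = ≰⇒> b≰d

module _ {A : Set} where

  ++-equidivisible : ∀ (a b c d : Word A) → a ++ b ≡ c ++ d →
    (∃ λ m → c ≡ a ++ m × b ≡ m ++ d) ⊎ (∃ λ m → a ≡ c ++ m × d ≡ m ++ b)
  ++-equidivisible []      b c       d eq = inj₁ (c , refl , eq)
  ++-equidivisible (x ∷ a) b []      d eq = inj₂ (x ∷ a , refl , sym eq)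
  ++-equidivisible (x ∷ a) b (y ∷ c) d eq with ∷-injective eq
  ... | refl , eq′ with ++-equidivisible a b c d eq′
  ...   | inj₁ (m , refl , b≡) = inj₁ (m , refl , b≡)
  ...   | inj₂ (m , refl , d≡) = inj₂ (m , refl , d≡)

  ++-assoc₃ : ∀ (a b c d : Word A) → (a ++ b ++ c) ++ d ≡ a ++ b ++ c ++ d
  ++-assoc₃ a b c d = solve (++-monoid A)

  length-++-≡ : ∀ (a b c d : Word A) → a ++ b ≡ c ++ d →
    length a + length b ≡ length c + length d
  length-++-≡ a b c d eq = trans (sym (length-++ a)) (trans (cong length eq) (length-++ c))

  overlap-swap : ∀ {u v x y s t} → Overlap A u v x y s t → Overlap A v u s t x y
  overlap-swap {u} {v} {y = y} {s} (eq , inj₁ (refl , refl , y<v)) =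
    sym eq , inj₂ (inj₁ (refl , refl , +-<-transfer lengths y<v))
    where
    lengths : length y + length u ≡ length v + length s
    lengths = trans (+-comm (length y) (length u))
                (trans (length-++-≡ u y s v (trans eq (cong (s ++_) (++-identityʳ v))))
                       (+-comm (length s) (length v)))
  overlap-swap {u} {v} {x} {t = t} (eq , inj₂ (inj₁ (refl , refl , x<v))) =
    sym eq , inj₁ (refl , refl , +-<-transfer lengths x<v)
    where
    lengths : length x + length u ≡ length v + length t
    lengths = length-++-≡ x u v t (trans (cong (x ++_) (sym (++-identityʳ u))) eq)
  overlap-swap (eq , inj₂ (inj₂ (inj₁ (refl , refl , s≢[] , t≢[])))) =
    sym eq , inj₂ (inj₂ (inj₂ (refl , refl , s≢[] , t≢[])))
  overlap-swap (eq , inj₂ (inj₂ (inj₂ (refl , refl , x≢[] , y≢[])))) =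
    sym eq , inj₂ (inj₂ (inj₁ (refl , refl , x≢[] , y≢[])))

  data Arrangement (p u q p′ v q′ : Word A) : Set where
    u-before-v  : ∀ r → p′ ≡ p ++ u ++ r → q ≡ r ++ v ++ q′ → Arrangement p u q p′ v q′
    v-before-u  : ∀ r → p ≡ p′ ++ v ++ r → q′ ≡ r ++ u ++ q → Arrangement p u q p′ v q′
    overlapping : ∀ c d x y s t → Overlap A u v x y s t →
                  p ≡ c ++ x → q ≡ y ++ d → p′ ≡ c ++ s → q′ ≡ t ++ d → Arrangement p u q p′ v q′

  arrangement-swap : ∀ {p u q p′ v q′} →
    Arrangement p′ v q′ p u q → Arrangement p u q p′ v q′
  arrangement-swap (u-before-v r p≡ q′≡) = v-before-u r p≡ q′≡
  arrangement-swap (v-before-u r p′≡ q≡) = u-before-v r p′≡ q≡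
  arrangement-swap (overlapping c d x y s t o p′≡ q′≡ p≡ q≡) =
    overlapping c d s t x y (overlap-swap o) p≡ q≡ p′≡ q′≡

  arrangement-extend : ∀ {p u q p′ v q′} c →
    Arrangement p u q p′ v q′ → Arrangement (c ++ p) u q (c ++ p′) v q′
  arrangement-extend c (u-before-v r refl q≡) =
    u-before-v r (solve (++-monoid A)) q≡
  arrangement-extend c (v-before-u r refl q′≡) =
    v-before-u r (solve (++-monoid A)) q′≡
  arrangement-extend c (overlapping c′ d x y s t o refl q≡ refl q′≡) =
    overlapping (c ++ c′) d x y s t o (solve (++-monoid A)) q≡ (solve (++-monoid A)) q′≡

  factor-arrangement : ∀ m v k q → Arrangement [] (m ++ v ++ k) q m v (k ++ q)
  factor-arrangement []      []      k       q = v-before-u [] refl refl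
  factor-arrangement []      (a ∷ v) k       q =
    overlapping [] q [] [] [] k (++-identityʳ _ , inj₂ (inj₁ (refl , refl , s≤s z≤n)))
                refl refl refl refl
  factor-arrangement (a ∷ m) []      []      q =
    u-before-v [] (cong (a ∷_) (solve (++-monoid A))) refl
  factor-arrangement (a ∷ m) (b ∷ v) []      q =
    overlapping [] q [] [] (a ∷ m) [] (++-identityʳ _ , inj₁ (refl , refl , s≤s z≤n))
                refl refl refl refl
  factor-arrangement (a ∷ m) v       (b ∷ k) q =
    overlapping [] q [] [] (a ∷ m) (b ∷ k)
                (++-identityʳ _ , inj₂ (inj₂ (inj₁ (refl , refl , (λ ()) , (λ ())))))
                refl refl refl refl

  straddle-arrangement : ∀ m n k q′ → Arrangement [] (m ++ n) (k ++ q′) m (n ++ k) q′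
  straddle-arrangement m []      k q′ = u-before-v [] (solve (++-monoid A)) refl
  straddle-arrangement m (a ∷ n) k q′ =
    overlapping [] q′ [] k m []
                (trans (++-assoc m (a ∷ n) k) (cong (m ++_) (sym (++-identityʳ _))) ,
                 inj₁ (refl , refl , k<a∷n++k))
                refl refl refl refl
    where
    k<a∷n++k : length k < length (a ∷ n ++ k)
    k<a∷n++k = s≤s (≤-trans (m≤n+m (length k) (length n)) (≤-reflexive (sym (length-++ n))))

  arrangement-from-start : ∀ u q m v q′ → u ++ q ≡ m ++ v ++ q′ → Arrangement [] u q m v q′
  arrangement-from-start u q m v q′ eq with ++-equidivisible u q m (v ++ q′) eq
  ... | inj₁ (r , refl , q≡) = u-before-v r refl q≡
  ... | inj₂ (n , refl , eq′) with ++-equidivisible v q′ n q eq′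
  ...   | inj₁ (k , refl , refl) = factor-arrangement m v k q
  ...   | inj₂ (k , refl , refl) = straddle-arrangement m n k q′

  arrangement : ∀ p u q p′ v q′ → p ++ u ++ q ≡ p′ ++ v ++ q′ → Arrangement p u q p′ v q′
  arrangement p u q p′ v q′ eq with ++-equidivisible p (u ++ q) p′ (v ++ q′) eq
  ... | inj₁ (m , refl , eq′) =
    subst (λ p₀ → Arrangement p₀ u q (p ++ m) v q′) (++-identityʳ p)
          (arrangement-extend p (arrangement-from-start u q m v q′ eq′))
  ... | inj₂ (m , refl , eq′) =
    subst (λ p₀ → Arrangement (p′ ++ m) u q p₀ v q′) (++-identityʳ p′)
          (arrangement-extend p′ (arrangement-swap (arrangement-from-start v q′ m u q eq′)))

  word-matches : ∀ u → ⟦_⟧ A (word A u) u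
  word-matches []      = one
  word-matches (a ∷ u) = cat (lit a) (word-matches u)

  word-matches-only : ∀ u {z} → ⟦_⟧ A (word A u) z → z ≡ u
  word-matches-only []      one               = refl
  word-matches-only (a ∷ u) (cat (lit .a) z∈) = cong (a ∷_) (word-matches-only u z∈)

  ctx-word⁺ : ∀ {L : Language A} p u q →
    L (p ++ u ++ q) → _⊆_ A (ctx A p (⟦_⟧ A (word A u)) q) L
  ctx-word⁺ p u q puq∈L _ (z , z∈u , refl) with word-matches-only u z∈u
  ... | refl = puq∈L

  ctx-word⁻ : ∀ {L : Language A} p u q →
    _⊆_ A (ctx A p (⟦_⟧ A (word A u)) q) L → L (p ++ u ++ q)
  ctx-word⁻ p u q ⊆L = ⊆L _ (u , word-matches u , refl)

  ctx-ctx⁺ : ∀ {K : Language A} c x y d →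
    _⊆_ A (ctx A (c ++ x) K (y ++ d)) (ctx A c (ctx A x K y) d)
  ctx-ctx⁺ c x y d _ (z , z∈K , refl) = x ++ z ++ y , (z , z∈K , refl) , solve (++-monoid A)

  ctx-ctx⁻ : ∀ {K : Language A} c x y d →
    _⊆_ A (ctx A c (ctx A x K y) d) (ctx A (c ++ x) K (y ++ d))
  ctx-ctx⁻ c x y d _ (_ , (z , z∈K , refl) , refl) = z , z∈K , solve (++-monoid A)

  step-intro : ∀ {G : HypSet A} {L e f} p z q {w} → G (e , f) →
    _⊆_ A (ctx A p (⟦_⟧ A f) q) L → ⟦_⟧ A e z → w ≡ p ++ z ++ q → step A G L w
  step-intro {e = e} {f} p z q e≤f ⊆L z∈e w≡ = e , f , p , q , e≤f , ⊆L , z , z∈e , w≡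

  contextual-extend : ∀ {g K M L} c d → Contextual A g → _⊆_ A K (g M) →
    _⊆_ A (ctx A c M d) L → _⊆_ A (ctx A c K d) (g L)
  contextual-extend {M = M} c d (mono , g-ctx) K⊆gM cMd⊆L w (z , z∈K , refl) =
    mono _ _ cMd⊆L w (g-ctx c d M w (z , K⊆gM z z∈K , refl))

  disjoint-steps-commuteˡ : ∀ {Hi Hj : HypSet A} {L e f} u v p r q {w} →
    Hi (e , word A u) → Hj (word A v , f) →
    _⊆_ A (ctx A (p ++ u ++ r) (⟦_⟧ A f) q) L → ⟦_⟧ A e w →
    step A Hj (step A Hi L) (p ++ w ++ r ++ v ++ q)
  disjoint-steps-commuteˡ {Hi} {L = L} {f = f} u v p r q {w} e≤u v≤f ⊆L w∈e =
    step-intro (p ++ w ++ r) v q v≤f rewrite-u (word-matches v) (sym (++-assoc₃ p w r (v ++ q)))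
    where
    rewrite-u : _⊆_ A (ctx A (p ++ w ++ r) (⟦_⟧ A f) q) (step A Hi L)
    rewrite-u _ (z , z∈f , refl) =
      step-intro p w (r ++ z ++ q) e≤u
        (ctx-word⁺ p u (r ++ z ++ q)
                   (subst L (++-assoc₃ p u r (z ++ q)) (⊆L _ (z , z∈f , refl))))
        w∈e (++-assoc₃ p w r (z ++ q))

  disjoint-steps-commuteʳ : ∀ {Hi Hj : HypSet A} {L e f} u v p r q {w} →
    Hi (e , word A u) → Hj (word A v , f) →
    _⊆_ A (ctx A p (⟦_⟧ A f) (r ++ u ++ q)) L → ⟦_⟧ A e w →
    step A Hj (step A Hi L) ((p ++ v ++ r) ++ w ++ q)
  disjoint-steps-commuteʳ {Hi} {L = L} {f = f} u v p r q {w} e≤u v≤f ⊆L w∈e =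
    step-intro p v (r ++ w ++ q) v≤f rewrite-u (word-matches v) (++-assoc₃ p v r (w ++ q))
    where
    rewrite-u : _⊆_ A (ctx A p (⟦_⟧ A f) (r ++ w ++ q)) (step A Hi L)
    rewrite-u _ (z , z∈f , refl) =
      step-intro (p ++ z ++ r) w q e≤u
        (ctx-word⁺ (p ++ z ++ r) u q
                   (subst L (sym (++-assoc₃ p z r (u ++ q))) (⊆L _ (z , z∈f , refl))))
        w∈e (sym (++-assoc₃ p z r (w ++ q)))

proposition5p10 : (A : Set) (Hi Hj : HypSet A) (g : Language A → Language A)
    → RhsWords A Hi → LhsWords A Hj → Contextual A g
    → (∀ e u v f x y s t → Hi (e , word A u) → Hj (word A v , f)
        → Overlap A u v x y s t
        → _⊆_ A (ctx A x (⟦_⟧ A e) y) (g (ctx A s (⟦_⟧ A f) t)))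
    → _⊑_ A (_∘ₗ_ A (step A Hi) (step A Hj)) (_∪ₗ_ A (_∘ₗ_ A (step A Hj) (step A Hi)) g)
proposition5p10 A Hi Hj g rhs-words lhs-words g-contextual critical L w
                 (e , _ , p , q , e≤u , ⊆HjL , ew , ew∈e , refl)
  with rhs-words e _ e≤u
... | u , refl with ctx-word⁻ p u q ⊆HjL
... | (_ , f , p′ , q′ , v≤f , ⊆L , _ , v∈ , puq≡) with lhs-words _ f v≤f
... | v , refl with word-matches-only v v∈
... | refl with arrangement p u q p′ v q′ puq≡
... | u-before-v r refl refl = inj₁ (disjoint-steps-commuteˡ u v p r q′ e≤u v≤f ⊆L ew∈e)
... | v-before-u r refl refl = inj₁ (disjoint-steps-commuteʳ u v p′ r q e≤u v≤f ⊆L ew∈e)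
... | overlapping c d x y s t o refl refl refl refl =
  inj₂ (contextual-extend c d g-contextual (critical e u v f x y s t e≤u v≤f o)
                          (λ z → ⊆L z ∘ ctx-ctx⁻ c s t d z)
                          _ (ctx-ctx⁺ c x y d _ (ew , ew∈e , refl)))
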